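{- Let $g$ be a positive integer. For all integers $n>1$, $\frac{\eta_g(n)}{\sqrt{n}}\ge\sqrt{2g}$.
   Context: For a positive integer $n$ write $[n]=\{1,\dots,n\}$. For a set $A$ of integers and an integer $d$, let $r_{A-A}(d)=|\{(a,a')\in A\times A: d=a-a'\}|$. Define $\eta_g(n)=\min\{|A| : A\subseteq\mathbb{Z},\ r_{A-A}(x)\ge g\text{ for all }x\in[n]\}$. -}

module Defs where

open import Data.Nat using (ℕ; suc; _≤_; _*_)
open import Data.Integer as ℤ using (ℤ; +_; _-_)
open import Data.List using (List; length; filter; cartesianProduct)
open import Data.List.Relation.Unary.Unique.Propositional using (Unique)
open import Data.Product using (_×_; proj₁; proj₂; Σ)

FinSetℤ : Set
FinSetℤ = Σ (List ℤ) Unique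

card : FinSetℤ → ℕ
card A = length (proj₁ A)

rDiff : FinSetℤ → ℤ → ℕ
rDiff A d = length (filter (λ p → (proj₁ p - proj₂ p) ℤ.≟ d) (cartesianProduct (proj₁ A) (proj₁ A)))

-- A is admissible for η_g(n): r_{A-A}(x) ≥ g for all x ∈ [n] = {1,…,n}
Admissible : ℕ → ℕ → FinSetℤ → Set
Admissible g n A = (x : ℕ) → 1 ≤ x → x ≤ n → g ≤ rDiff A (+ x)

-- Sum r_{A-A}(x) over x ∈ [n]: every term is at least g, so the sum is at least g n.  On the
-- other hand it counts the ordered pairs (a, b) ∈ A × A with a - b ∈ [n], and of the two
-- pairs (a, b), (b, a) at most one has its difference in [n]; counting both orientations
-- therefore gives 2 g n ≤ |A|².
module Submission where

open import Defs
open import Data.Nat using (ℕ; suc; z≤n; s≤s; _+_; _*_; _≤_; _<_)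
open import Data.Nat.Properties
  using (+-mono-≤; *-monoʳ-≤; *-assoc; *-comm; *-zeroʳ; *-identityʳ; +-identityʳ;
         ≤-reflexive; suc-injective; +-commutativeSemigroup; module ≤-Reasoning)
open import Data.Nat.ListAction using (sum)
open import Data.Nat.ListAction.Properties using (sum-++)
open import Data.Integer as ℤ using (ℤ; +_; 0ℤ; -_; _-_)
open import Data.Integer.Base using (+≤+)
import Data.Integer.Properties as ℤ
open import Data.List using (List; []; _∷_; _++_; length; map; filter; cartesianProduct; downFrom)
open import Data.List.Properties using (map-++; map-cong; map-∘; length-map; length-downFrom)
open import Data.List.Membership.Propositional using (_∈_)
open import Data.List.Membership.Propositional.Properties using (∈-map⁻; ∈-downFrom⁻)
open import Data.List.Relation.Unary.All as All using (All; []; _∷_)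
import Data.List.Relation.Unary.All.Properties as All
open import Data.List.Relation.Unary.Any using (here; there)
open import Data.List.Relation.Unary.AllPairs using ([]; _∷_)
open import Data.List.Relation.Unary.Unique.Propositional using (Unique)
import Data.List.Relation.Unary.Unique.Propositional.Properties as Unique
open import Data.Product using (_×_; _,_; proj₁)
open import Data.Sum using (inj₁; inj₂)
open import Relation.Binary.Definitions using (DecidableEquality)
open import Relation.Binary.PropositionalEquality
open import Relation.Nullary using (Dec; yes; no; contradiction)
open import Relation.Unary using (Decidable)
open import Function using (_∘_; case_of_)
open import Algebra.Properties.CommutativeSemigroup +-commutativeSemigroup using (interchange)
open import Algebra.Properties.AbelianGroup ℤ.+-0-abelianGroup using (⁻¹-anti-homo‿-)

private
  variable
    A B : Set

𝟙 : {P : Set} → Dec P → ℕ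
𝟙 (yes _) = 1
𝟙 (no _) = 0

∑ : List A → (A → ℕ) → ℕ
∑ xs f = sum (map f xs)

syntax ∑ xs (λ x → e) = ∑[ x ∈ xs ] e

∑-cong : ∀ (xs : List A) {f h : A → ℕ} → (∀ x → f x ≡ h x) → ∑ xs f ≡ ∑ xs h
∑-cong xs f≗h = cong sum (map-cong f≗h xs)

∑-mono-≤ : ∀ (xs : List A) {f h : A → ℕ} → (∀ x → f x ≤ h x) → ∑ xs f ≤ ∑ xs h
∑-mono-≤ []       f≤h = z≤n
∑-mono-≤ (x ∷ xs) f≤h = +-mono-≤ (f≤h x) (∑-mono-≤ xs f≤h)

∑-const : ∀ (xs : List A) c → ∑[ _ ∈ xs ] c ≡ length xs * c
∑-const []       c = refl
∑-const (x ∷ xs) c = cong (λ t → c + t) (∑-const xs c)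

∑-zero : ∀ (xs : List A) → ∑[ _ ∈ xs ] 0 ≡ 0
∑-zero xs = trans (∑-const xs 0) (*-zeroʳ (length xs))

∑-+ : ∀ (xs : List A) (f h : A → ℕ) → ∑ xs f + ∑ xs h ≡ ∑[ x ∈ xs ] (f x + h x)
∑-+ []       f h = refl
∑-+ (x ∷ xs) f h =
  trans (interchange (f x) (∑ xs f) (h x) (∑ xs h)) (cong (λ t → f x + h x + t) (∑-+ xs f h))

∑-≥-length* : ∀ (xs : List A) {f : A → ℕ} {g} → (∀ {x} → x ∈ xs → g ≤ f x) →
              length xs * g ≤ ∑ xs f
∑-≥-length* []       g≤f = z≤n
∑-≥-length* (x ∷ xs) g≤f = +-mono-≤ (g≤f (here refl)) (∑-≥-length* xs (g≤f ∘ there))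

∑-swap : ∀ (xs : List A) (ys : List B) (h : A → B → ℕ) →
         ∑[ a ∈ xs ] ∑[ b ∈ ys ] h a b ≡ ∑[ b ∈ ys ] ∑[ a ∈ xs ] h a b
∑-swap []       ys h = sym (∑-zero ys)
∑-swap (x ∷ xs) ys h =
  trans (cong (λ t → ∑ ys (h x) + t) (∑-swap xs ys h)) (∑-+ ys (h x) _)

∑-++ : ∀ (xs ys : List A) (f : A → ℕ) → ∑ (xs ++ ys) f ≡ ∑ xs f + ∑ ys f
∑-++ xs ys f = trans (cong sum (map-++ f xs ys)) (sum-++ (map f xs) (map f ys))

∑-map : ∀ (k : A → B) (xs : List A) (f : B → ℕ) → ∑ (map k xs) f ≡ ∑[ x ∈ xs ] f (k x)
∑-map k xs f = cong sum (sym (map-∘ xs))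

∑-cartesianProduct : ∀ (xs : List A) (ys : List B) (f : A × B → ℕ) →
                     ∑ (cartesianProduct xs ys) f ≡ ∑[ a ∈ xs ] ∑[ b ∈ ys ] f (a , b)
∑-cartesianProduct []       ys f = refl
∑-cartesianProduct (x ∷ xs) ys f = begin
  ∑ (map (x ,_) ys ++ cartesianProduct xs ys) f
    ≡⟨ ∑-++ (map (x ,_) ys) _ f ⟩
  ∑ (map (x ,_) ys) f + ∑ (cartesianProduct xs ys) f
    ≡⟨ cong₂ _+_ (∑-map (x ,_) ys f) (∑-cartesianProduct xs ys f) ⟩
  ∑[ b ∈ ys ] f (x , b) + ∑[ a ∈ xs ] ∑[ b ∈ ys ] f (a , b)
    ∎
  where open ≡-Reasoning

length-filter≡∑𝟙 : ∀ {P : A → Set} (P? : Decidable P) xs →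
                   length (filter P? xs) ≡ ∑[ x ∈ xs ] 𝟙 (P? x)
length-filter≡∑𝟙 P? []       = refl
length-filter≡∑𝟙 P? (x ∷ xs) with P? x
... | yes _ = cong suc (length-filter≡∑𝟙 P? xs)
... | no  _ = length-filter≡∑𝟙 P? xs

2*∑∑-≤-square : ∀ (xs : List A) (h : A → A → ℕ) → (∀ a b → h a b + h b a ≤ 1) →
                2 * ∑[ a ∈ xs ] ∑[ b ∈ xs ] h a b ≤ length xs * length xs
2*∑∑-≤-square xs h h≤1 = begin
  2 * S
    ≡⟨ cong (λ t → S + t) (+-identityʳ S) ⟩
  S + S
    ≡⟨ cong (λ t → S + t) (∑-swap xs xs h) ⟩
  S + ∑[ a ∈ xs ] ∑[ b ∈ xs ] h b a
    ≡⟨ ∑-+ xs _ _ ⟩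
  ∑[ a ∈ xs ] (∑[ b ∈ xs ] h a b + ∑[ b ∈ xs ] h b a)
    ≡⟨ ∑-cong xs (λ a → ∑-+ xs (h a) (λ b → h b a)) ⟩
  ∑[ a ∈ xs ] ∑[ b ∈ xs ] (h a b + h b a)
    ≤⟨ ∑-mono-≤ xs (λ a → ∑-mono-≤ xs (h≤1 a)) ⟩
  ∑[ a ∈ xs ] ∑[ b ∈ xs ] 1
    ≡⟨ ∑-cong xs (λ _ → trans (∑-const xs 1) (*-identityʳ _)) ⟩
  ∑[ a ∈ xs ] length xs
    ≡⟨ ∑-const xs (length xs) ⟩
  length xs * length xs
    ∎
  where
  open ≤-Reasoning
  S = ∑[ a ∈ xs ] ∑[ b ∈ xs ] h a b

module _ {A : Set} (_≟_ : DecidableEquality A) where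

  occurrences : List A → A → ℕ
  occurrences xs y = ∑[ x ∈ xs ] 𝟙 (y ≟ x)

  occurrences-∉ : ∀ {xs y} → All (y ≢_) xs → occurrences xs y ≡ 0
  occurrences-∉ []                       = refl
  occurrences-∉ {x ∷ _} {y} (y≢x ∷ ps) with y ≟ x
  ... | yes y≡x = contradiction y≡x y≢x
  ... | no  _   = occurrences-∉ ps

  occurrences-Unique : ∀ {xs} y → Unique xs → occurrences xs y ≤ 1
  occurrences-Unique          y []       = z≤n
  occurrences-Unique {x ∷ xs} y (x∉ ∷ u) with y ≟ x
  ... | yes refl = s≤s (≤-reflexive (occurrences-∉ x∉))
  ... | no  _    = occurrences-Unique y u

range : ℕ → List ℤ
range n = map (λ i → + suc i) (downFrom n)

length-range : ∀ n → length (range n) ≡ n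
length-range n = trans (length-map _ (downFrom n)) (length-downFrom n)

range-Unique : ∀ n → Unique (range n)
range-Unique n = Unique.map⁺ (suc-injective ∘ ℤ.+-injective) (Unique.downFrom⁺ n)

occurrences-range : ℕ → ℤ → ℕ
occurrences-range n = occurrences ℤ._≟_ (range n)

occurrences-range-nonpositive : ∀ n {z} → z ℤ.≤ 0ℤ → occurrences-range n z ≡ 0
occurrences-range-nonpositive n {z} z≤0 =
  occurrences-∉ ℤ._≟_ (All.map⁺ (All.universal z≢+suc (downFrom n)))
  where
  z≢+suc : ∀ i → z ≢ + suc i
  z≢+suc i refl = case z≤0 of λ { (+≤+ ()) }

occurrences-range-± : ∀ n z → occurrences-range n z + occurrences-range n (- z) ≤ 1
occurrences-range-± n z with ℤ.≤-total z 0ℤ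
... | inj₁ z≤0 rewrite occurrences-range-nonpositive n z≤0 =
  occurrences-Unique ℤ._≟_ (- z) (range-Unique n)
... | inj₂ 0≤z rewrite occurrences-range-nonpositive n (ℤ.neg-mono-≤ 0≤z)
                    | +-identityʳ (occurrences-range n z) =
  occurrences-Unique ℤ._≟_ z (range-Unique n)

occurrences-range-swap : ∀ n a b → occurrences-range n (a - b) + occurrences-range n (b - a) ≤ 1
occurrences-range-swap n a b rewrite sym (⁻¹-anti-homo‿- a b) = occurrences-range-± n (a - b)

Admissible⇒*≤∑-rDiff : ∀ {g n} A → Admissible g n A → n * g ≤ ∑[ d ∈ range n ] rDiff A d
Admissible⇒*≤∑-rDiff {g} {n} A adm =
  subst (λ m → m * g ≤ ∑[ d ∈ range n ] rDiff A d) (length-range n) (∑-≥-length* (range n) g≤rDiff)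
  where
  g≤rDiff : ∀ {d} → d ∈ range n → g ≤ rDiff A d
  g≤rDiff d∈ with i , i∈ , refl ← ∈-map⁻ _ d∈ = adm (suc i) (s≤s z≤n) (∈-downFrom⁻ i∈)

rDiff≡∑∑ : ∀ A d → rDiff A d ≡ ∑[ a ∈ proj₁ A ] ∑[ b ∈ proj₁ A ] 𝟙 (a - b ℤ.≟ d)
rDiff≡∑∑ (xs , _) d =
  trans (length-filter≡∑𝟙 _ (cartesianProduct xs xs)) (∑-cartesianProduct xs xs _)

∑-range-rDiff : ∀ n A → ∑[ d ∈ range n ] rDiff A d
                      ≡ ∑[ a ∈ proj₁ A ] ∑[ b ∈ proj₁ A ] occurrences-range n (a - b)
∑-range-rDiff n A@(xs , _) = begin
  ∑[ d ∈ range n ] rDiff A d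
    ≡⟨ ∑-cong (range n) (rDiff≡∑∑ A) ⟩
  ∑[ d ∈ range n ] ∑[ a ∈ xs ] ∑[ b ∈ xs ] 𝟙 (a - b ℤ.≟ d)
    ≡⟨ ∑-swap (range n) xs _ ⟩
  ∑[ a ∈ xs ] ∑[ d ∈ range n ] ∑[ b ∈ xs ] 𝟙 (a - b ℤ.≟ d)
    ≡⟨ ∑-cong xs (λ a → ∑-swap (range n) xs _) ⟩
  ∑[ a ∈ xs ] ∑[ b ∈ xs ] ∑[ d ∈ range n ] 𝟙 (a - b ℤ.≟ d)
    ∎
  where open ≡-Reasoning

lemma1 : (g : ℕ) → 1 ≤ g → (n : ℕ) → 1 < n →
    (A : FinSetℤ) → Admissible g n A →
    2 * g * n ≤ card A * card A
lemma1 g _ n _ A adm = begin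
  2 * g * n
    ≡⟨ trans (*-assoc 2 g n) (cong (2 *_) (*-comm g n)) ⟩
  2 * (n * g)
    ≤⟨ *-monoʳ-≤ 2 (Admissible⇒*≤∑-rDiff A adm) ⟩
  2 * ∑[ d ∈ range n ] rDiff A d
    ≡⟨ cong (2 *_) (∑-range-rDiff n A) ⟩
  2 * ∑[ a ∈ proj₁ A ] ∑[ b ∈ proj₁ A ] occurrences-range n (a - b)
    ≤⟨ 2*∑∑-≤-square (proj₁ A) _ (occurrences-range-swap n) ⟩
  card A * card A
    ∎
  where open ≤-Reasoning
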